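{- Let $\{z_n\}_{n\geq 0}$ be a sequence of positive real numbers satisfying the three-term recurrence $$a(n)z_{n+1}+b(n)z_n+c(n)z_{n-1}=0,\qquad n\geq 1,$$ where $a(n),b(n),c(n)$ are real-valued functions of $n$. Suppose there exists an integer $N$ such that for every $n>N$: (i) $a(n)>0$; (ii) $\Delta_n:=b(n)^2-4a(n)c(n)\geq 0$; (iii) $\displaystyle \frac{ -b(n)-\sqrt{\Delta_n}}{2a(n)}\leq \frac{z_n}{z_{n-1}}\leq \frac{ -b(n)+\sqrt{\Delta_n}}{2a(n)}$. Then the sequence $\{z_n\}_{n\geq N}$ is log-convex, i.e. $z_n^2\leq z_{n-1}z_{n+1}$ for all $n\geq N+1$.
   Context: A sequence $\{z_n\}$ of positive numbers is log-convex if $z_{n-1}z_{n+1}\geq z_n^2$ for all indices $n$ for which $z_{n-1},z_n,z_{n+1}$ belong to the sequence. -}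

module Defs where

open import Data.Nat using (ℕ)
open import Data.Product using (Σ; ∃; _×_; _,_)
open import Data.Sum using (_⊎_)
open import Relation.Binary.PropositionalEquality using (_≡_)
open import Relation.Nullary using (¬_)

-- The real numbers, given axiomatically as a complete ordered field
-- (unique up to isomorphism), with a square-root function on the
-- nonnegative elements and a total multiplicative inverse (x ⁻¹ is only
-- constrained for x ≠ 0, as usual).
record Reals : Set₁ where
  infixl 6 _+_
  infixl 7 _*_
  infix  8 -_
  infix  4 _≤_
  field
    Carrier : Set
    0# 1#   : Carrier
    _+_ _*_ : Carrier → Carrier → Carrier
    -_      : Carrier → Carrier
    _⁻¹     : Carrier → Carrier
    _≤_     : Carrier → Carrier → Set
    √       : Carrier → Carrier
    +-assoc     : ∀ x y z → (x + y) + z ≡ x + (y + z)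
    +-comm      : ∀ x y → x + y ≡ y + x
    +-identityˡ : ∀ x → 0# + x ≡ x
    +-inverseˡ  : ∀ x → (- x) + x ≡ 0#
    *-assoc     : ∀ x y z → (x * y) * z ≡ x * (y * z)
    *-comm      : ∀ x y → x * y ≡ y * x
    *-identityˡ : ∀ x → 1# * x ≡ x
    *-inverseˡ  : ∀ x → ¬ (x ≡ 0#) → (x ⁻¹) * x ≡ 1#
    distribˡ    : ∀ x y z → x * (y + z) ≡ x * y + x * z
    0≢1         : ¬ (0# ≡ 1#)
    ≤-refl      : ∀ x → x ≤ x
    ≤-trans     : ∀ {x y z} → x ≤ y → y ≤ z → x ≤ z
    ≤-antisym   : ∀ {x y} → x ≤ y → y ≤ x → x ≡ y
    ≤-total     : ∀ x y → (x ≤ y) ⊎ (y ≤ x)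
    +-mono-≤    : ∀ {x y} z → x ≤ y → x + z ≤ y + z
    *-nonneg    : ∀ {x y} → 0# ≤ x → 0# ≤ y → 0# ≤ x * y
    complete    : (P : Carrier → Set) → Σ Carrier P →
                  Σ Carrier (λ u → ∀ x → P x → x ≤ u) →
                  Σ Carrier (λ s → (∀ x → P x → x ≤ s) ×
                                   (∀ u → (∀ x → P x → x ≤ u) → s ≤ u))
    √-nonneg    : ∀ x → 0# ≤ x → 0# ≤ √ x
    √-square    : ∀ x → 0# ≤ x → √ x * √ x ≡ x

  infix 4 _<_
  _<_ : Carrier → Carrier → Set
  x < y = (x ≤ y) × ¬ (x ≡ y)

  infixl 6 _-_
  _-_ : Carrier → Carrier → Carrier
  x - y = x + (- y)

  infixl 7 _/_
  _/_ : Carrier → Carrier → Carrier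
  x / y = x * (y ⁻¹)

  2# 4# : Carrier
  2# = 1# + 1#
  4# = 2# + 2#

-- With r = z n / z (n - 1) and p = 2 a(n) r + b(n), hypothesis (iii) says -√Δ ≤ p ≤ √Δ, so
-- p² ≤ Δ; completing the square, p² - Δ = 4 a(n) (a(n) r² + b(n) r + c(n)), hence r lies where
-- the characteristic quadratic is nonpositive. Multiplied by z (n - 1)², this says
-- a z n² + b z n z (n - 1) + c z (n - 1)² ≤ 0, while the recurrence (times z (n - 1)) says the
-- same expression with z n² replaced by z (n - 1) z (n + 1) vanishes; divide the difference by a(n) > 0.
module Submission where

open import Defs
open import Algebra.Bundles using (CommutativeRing)
open import Data.Nat using (ℕ; suc; pred; s≤s) renaming (_<_ to _<ℕ_; _≤_ to _≤ℕ_)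
open import Data.Product using (_×_; _,_; proj₁; proj₂)
open import Data.Sum using (inj₁; inj₂)
open import Relation.Binary.Structures using (IsPreorder)
open import Relation.Binary.PropositionalEquality
open import Relation.Nullary using (¬_)

module OrderedFieldProperties (R : Reals) where
  open Reals R

  commutativeRing : CommutativeRing _ _
  commutativeRing = record
    { Carrier = Carrier ; _≈_ = _≡_ ; _+_ = _+_ ; _*_ = _*_ ; -_ = -_ ; 0# = 0# ; 1# = 1#
    ; isCommutativeRing = record
      { isRing = record
        { +-isAbelianGroup = record
          { isGroup = record
            { isMonoid = record
              { isSemigroup = record
                { isMagma = record { isEquivalence = isEquivalence ; ∙-cong = cong₂ _+_ }
                ; assoc = +-assoc }
              ; identity = +-identityˡ , +-identityʳ }
            ; inverse = +-inverseˡ , +-inverseʳ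
            ; ⁻¹-cong = cong (λ x → - x) }
          ; comm = +-comm }
        ; *-cong = cong₂ _*_
        ; *-assoc = *-assoc
        ; *-identity = *-identityˡ , *-identityʳ
        ; distrib = distribˡ , distribʳ }
      ; *-comm = *-comm } }
    where
    +-identityʳ : ∀ x → x + 0# ≡ x
    +-identityʳ x = trans (+-comm x 0#) (+-identityˡ x)
    +-inverseʳ : ∀ x → x + - x ≡ 0#
    +-inverseʳ x = trans (+-comm x (- x)) (+-inverseˡ x)
    *-identityʳ : ∀ x → x * 1# ≡ x
    *-identityʳ x = trans (*-comm x 1#) (*-identityˡ x)
    distribʳ : ∀ x y z → (y + z) * x ≡ y * x + z * x
    distribʳ x y z = trans (*-comm (y + z) x)
      (trans (distribˡ x y z) (cong₂ _+_ (*-comm x y) (*-comm x z)))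

  open CommutativeRing commutativeRing public
    using (+-identityʳ; -‿inverseʳ; *-identityʳ; zeroˡ)
  open import Algebra.Solver.Ring.NaturalCoefficients.Default
    (CommutativeRing.commutativeSemiring commutativeRing) public

  -x+y+x≡y : ∀ x y → - x + y + x ≡ y
  -x+y+x≡y x y = begin
    - x + y + x   ≡⟨ solve 3 (λ x′ y x → x′ :+ y :+ x := (x′ :+ x) :+ y) refl (- x) y x ⟩
    (- x + x) + y ≡⟨ cong (_+ y) (+-inverseˡ x) ⟩
    0# + y        ≡⟨ +-identityˡ y ⟩
    y             ∎
    where open ≡-Reasoning

  x-y+y≡x : ∀ x y → x - y + y ≡ x
  x-y+y≡x x y = begin
    x + - y + y   ≡⟨ +-assoc x (- y) y ⟩
    x + (- y + y) ≡⟨ cong (x +_) (+-inverseˡ y) ⟩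
    x + 0#        ≡⟨ +-identityʳ x ⟩
    x             ∎
    where open ≡-Reasoning

  x+y-y≡x : ∀ x y → x + y - y ≡ x
  x+y-y≡x x y = begin
    x + y + - y   ≡⟨ +-assoc x y (- y) ⟩
    x + (y + - y) ≡⟨ cong (x +_) (-‿inverseʳ y) ⟩
    x + 0#        ≡⟨ +-identityʳ x ⟩
    x             ∎
    where open ≡-Reasoning

  ≤-reflexive : ∀ {x y} → x ≡ y → x ≤ y
  ≤-reflexive {x} refl = ≤-refl x

  ≤-isPreorder : IsPreorder _≡_ _≤_
  ≤-isPreorder = record
    { isEquivalence = isEquivalence
    ; reflexive     = ≤-reflexive
    ; trans         = ≤-trans
    }

  module ≤-Reasoning where
    open import Relation.Binary.Reasoning.Base.Double ≤-isPreorder public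
    open import Relation.Binary.Reasoning.Syntax using (module ≤-syntax)
    open ≤-syntax _IsRelatedTo_ _IsRelatedTo_ ≲-go public

  +-cancelʳ-≤ : ∀ {x y} z → x + z ≤ y + z → x ≤ y
  +-cancelʳ-≤ {x} {y} z x+z≤y+z = begin
    x         ≡⟨ x+y-y≡x x z ⟨
    x + z - z ≤⟨ +-mono-≤ (- z) x+z≤y+z ⟩
    y + z - z ≡⟨ x+y-y≡x y z ⟩
    y         ∎
    where open ≤-Reasoning

  x≤y⇒0≤y-x : ∀ {x y} → x ≤ y → 0# ≤ y - x
  x≤y⇒0≤y-x {x} {y} x≤y = subst₂ _≤_ (-‿inverseʳ x) refl (+-mono-≤ (- x) x≤y)

  *-monoʳ-≤-nonneg : ∀ {k x y} → 0# ≤ k → x ≤ y → x * k ≤ y * k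
  *-monoʳ-≤-nonneg {k} {x} {y} 0≤k x≤y = begin
    x * k                  ≡⟨ +-identityˡ (x * k) ⟨
    0# + x * k             ≤⟨ +-mono-≤ (x * k) (*-nonneg (x≤y⇒0≤y-x x≤y) 0≤k) ⟩
    (y - x) * k + x * k    ≡⟨ solve 4 (λ y x′ x k → (y :+ x′) :* k :+ x :* k := (y :+ x′ :+ x) :* k) refl y (- x) x k ⟩
    (y - x + x) * k        ≡⟨ cong (_* k) (x-y+y≡x y x) ⟩
    y * k                  ∎
    where open ≤-Reasoning

  +-monoˡ-≤ : ∀ {x y} z → x ≤ y → z + x ≤ z + y
  +-monoˡ-≤ {x} {y} z x≤y = subst₂ _≤_ (+-comm x z) (+-comm y z) (+-mono-≤ z x≤y)

  +-pos : ∀ {x y} → 0# < x → 0# < y → 0# < x + y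
  +-pos {x} {y} (0≤x , 0≢x) (0≤y , _) = ≤-trans 0≤x x≤x+y , 0≢x+y
    where
    x≤x+y : x ≤ x + y
    x≤x+y = subst₂ _≤_ (+-identityʳ x) refl (+-monoˡ-≤ x 0≤y)
    0≢x+y : ¬ 0# ≡ x + y
    0≢x+y 0≡x+y = 0≢x (≤-antisym 0≤x (subst (x ≤_) (sym 0≡x+y) x≤x+y))

  >⇒≢0 : ∀ {x} → 0# < x → ¬ x ≡ 0#
  >⇒≢0 (_ , 0≢x) x≡0 = 0≢x (sym x≡0)

  x/k*k≡x : ∀ {k} x → ¬ k ≡ 0# → x / k * k ≡ x
  x/k*k≡x {k} x k≢0 = begin
    x * k ⁻¹ * k   ≡⟨ *-assoc x (k ⁻¹) k ⟩
    x * (k ⁻¹ * k) ≡⟨ cong (x *_) (*-inverseˡ k k≢0) ⟩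
    x * 1#         ≡⟨ *-identityʳ x ⟩
    x              ∎
    where open ≡-Reasoning

  x*k/k≡x : ∀ {k} x → ¬ k ≡ 0# → x * k / k ≡ x
  x*k/k≡x {k} x k≢0 =
    trans (solve 3 (λ x k k′ → x :* k :* k′ := x :* k′ :* k) refl x k (k ⁻¹)) (x/k*k≡x x k≢0)

  *-cancelʳ-≡ : ∀ {k x y} → ¬ k ≡ 0# → x * k ≡ y * k → x ≡ y
  *-cancelʳ-≡ {k} {x} {y} k≢0 xk≡yk = begin
    x         ≡⟨ x*k/k≡x x k≢0 ⟨
    x * k / k ≡⟨ cong (_/ k) xk≡yk ⟩
    y * k / k ≡⟨ x*k/k≡x y k≢0 ⟩
    y         ∎
    where open ≡-Reasoning

  *-cancelʳ-≤-pos : ∀ {k x y} → 0# < k → x * k ≤ y * k → x ≤ y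
  *-cancelʳ-≤-pos {k} {x} {y} 0<k xk≤yk with ≤-total x y
  ... | inj₁ x≤y = x≤y
  ... | inj₂ y≤x = ≤-reflexive
    (*-cancelʳ-≡ (>⇒≢0 0<k) (≤-antisym xk≤yk (*-monoʳ-≤-nonneg (proj₁ 0<k) y≤x)))

  /≤⇒≤* : ∀ {k x y} → 0# < k → x / k ≤ y → x ≤ y * k
  /≤⇒≤* {k} {x} {y} 0<k x/k≤y =
    subst (_≤ y * k) (x/k*k≡x x (>⇒≢0 0<k)) (*-monoʳ-≤-nonneg (proj₁ 0<k) x/k≤y)

  ≤/⇒*≤ : ∀ {k x y} → 0# < k → x ≤ y / k → x * k ≤ y
  ≤/⇒*≤ {k} {x} {y} 0<k x≤y/k =
    subst (x * k ≤_) (x/k*k≡x y (>⇒≢0 0<k)) (*-monoʳ-≤-nonneg (proj₁ 0<k) x≤y/k)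

module _ (R : Reals) where
  open Reals R
  open OrderedFieldProperties R

  quadratic : Carrier → Carrier → Carrier → Carrier → Carrier
  quadratic a b c x = a * x * x + b * x + c

  discriminant : Carrier → Carrier → Carrier → Carrier
  discriminant a b c = b * b - 4# * a * c

  -y≤x≤y⇒x*x≤y*y : ∀ {x y} → - y ≤ x → x ≤ y → x * x ≤ y * y
  -y≤x≤y⇒x*x≤y*y {x} {y} -y≤x x≤y = +-cancelʳ-≤ (y * x) (begin
    x * x + y * x ≡⟨ solve 2 (λ x y → x :* x :+ y :* x := x :* (x :+ y)) refl x y ⟩
    x * (x + y)   ≤⟨ *-monoʳ-≤-nonneg 0≤x+y x≤y ⟩
    y * (x + y)   ≡⟨ solve 2 (λ x y → y :* (x :+ y) := y :* y :+ y :* x) refl x y ⟩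
    y * y + y * x ∎)
    where
    open ≤-Reasoning
    0≤x+y : 0# ≤ x + y
    0≤x+y = subst₂ _≤_ (+-inverseˡ y) refl (+-mono-≤ y -y≤x)

  completing-the-square : ∀ a b c r →
    (r * (2# * a) + b) * (r * (2# * a) + b) + 4# * a * c ≡ quadratic a b c r * (4# * a) + b * b
  completing-the-square = solve 4 (λ a b c r →
    (r :* (con 2 :* a) :+ b) :* (r :* (con 2 :* a) :+ b) :+ (con 2 :+ con 2) :* a :* c
      := (a :* r :* r :+ b :* r :+ c) :* ((con 2 :+ con 2) :* a) :+ b :* b) refl

  between-roots⇒quadratic≤0 : ∀ {a b c r} → 0# < a → 0# ≤ discriminant a b c →
    (- b - √ (discriminant a b c)) / (2# * a) ≤ r →
    r ≤ (- b + √ (discriminant a b c)) / (2# * a) →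
    quadratic a b c r ≤ 0#
  between-roots⇒quadratic≤0 {a} {b} {c} {r} 0<a 0≤Δ lower upper =
    *-cancelʳ-≤-pos 0<4a (+-cancelʳ-≤ (b * b) (begin
      quadratic a b c r * (4# * a) + b * b ≡⟨ completing-the-square a b c r ⟨
      p * p + 4# * a * c                   ≤⟨ +-mono-≤ (4# * a * c) p*p≤Δ ⟩
      b * b - 4# * a * c + 4# * a * c      ≡⟨ x-y+y≡x (b * b) (4# * a * c) ⟩
      b * b                                ≡⟨ +-identityˡ (b * b) ⟨
      0# + b * b                           ≡⟨ cong (_+ b * b) (zeroˡ (4# * a)) ⟨
      0# * (4# * a) + b * b                ∎))
    where
    open ≤-Reasoning
    s p : Carrier
    s = √ (discriminant a b c)
    p = r * (2# * a) + b
    0<2a : 0# < 2# * a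
    0<2a = subst (0# <_) (solve 1 (λ a → a :+ a := con 2 :* a) refl a) (+-pos 0<a 0<a)
    0<4a : 0# < 4# * a
    0<4a = subst (0# <_) (solve 1 (λ a → con 2 :* a :+ con 2 :* a := (con 2 :+ con 2) :* a) refl a)
      (+-pos 0<2a 0<2a)
    -s≤p : - s ≤ p
    -s≤p = subst (_≤ p) (-x+y+x≡y b (- s)) (+-mono-≤ b (/≤⇒≤* 0<2a lower))
    p≤s : p ≤ s
    p≤s = subst (p ≤_) (-x+y+x≡y b s) (+-mono-≤ b (≤/⇒*≤ 0<2a upper))
    p*p≤Δ : p * p ≤ discriminant a b c
    p*p≤Δ = subst (p * p ≤_) (√-square _ 0≤Δ) (-y≤x≤y⇒x*x≤y*y -s≤p p≤s)

  quadratic≤0⇒log-convex : ∀ {a b c u v w} → 0# < a → 0# < v →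
    a * u + b * w + c * v ≡ 0# → quadratic a b c (w / v) ≤ 0# → w * w ≤ v * u
  quadratic≤0⇒log-convex {a} {b} {c} {u} {v} {w} 0<a 0<v recurrence q≤0 =
    *-cancelʳ-≤-pos 0<a (+-cancelʳ-≤ (b * w * v + c * v * v) (begin
      w * w * a + (b * w * v + c * v * v) ≡⟨ homogenise ⟩
      quadratic a b c (w / v) * (v * v)   ≤⟨ *-monoʳ-≤-nonneg 0≤v*v q≤0 ⟩
      0# * (v * v)                        ≡⟨ zeroˡ (v * v) ⟩
      0#                                  ≡⟨ zeroˡ v ⟨
      0# * v                              ≡⟨ cong (_* v) recurrence ⟨
      (a * u + b * w + c * v) * v         ≡⟨ solve 6 (λ a b c u v w →
                                               (a :* u :+ b :* w :+ c :* v) :* v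
                                                 := v :* u :* a :+ (b :* w :* v :+ c :* v :* v))
                                               refl a b c u v w ⟩
      v * u * a + (b * w * v + c * v * v) ∎))
    where
    open ≤-Reasoning
    0≤v*v : 0# ≤ v * v
    0≤v*v = *-nonneg (proj₁ 0<v) (proj₁ 0<v)
    homogenise : w * w * a + (b * w * v + c * v * v) ≡ quadratic a b c (w / v) * (v * v)
    homogenise = trans
      (cong (λ t → t * t * a + (b * t * v + c * v * v)) (sym (x/k*k≡x w (>⇒≢0 0<v))))
      (solve 5 (λ a b c r v → r :* v :* (r :* v) :* a :+ (b :* (r :* v) :* v :+ c :* v :* v)
                  := (a :* r :* r :+ b :* r :+ c) :* (v :* v)) refl a b c (w / v) v)

theorem2p1 : (R : Reals) → let open Reals R in
    (z a b c : ℕ → Carrier) (N : ℕ) →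
    (∀ n → 0# < z n) →
    (∀ m → a (suc m) * z (suc (suc m)) + b (suc m) * z (suc m) + c (suc m) * z m ≡ 0#) →
    (∀ n → N <ℕ n → 0# < a n) →
    (∀ n → N <ℕ n → 0# ≤ b n * b n - 4# * a n * c n) →
    (∀ n → N <ℕ n →
    ((- b n - √ (b n * b n - 4# * a n * c n)) / (2# * a n) ≤ z n / z (pred n))
    × (z n / z (pred n) ≤ (- b n + √ (b n * b n - 4# * a n * c n)) / (2# * a n))) →
    ∀ n → suc N ≤ℕ n → z n * z n ≤ z (pred n) * z (suc n)
theorem2p1 R z a b c N z-pos recurrence a-pos Δ-nonneg between-roots n@(suc m) N<n@(s≤s _) =
  quadratic≤0⇒log-convex R (a-pos n N<n) (z-pos m) (recurrence m)
    (between-roots⇒quadratic≤0 R (a-pos n N<n) (Δ-nonneg n N<n)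
      (proj₁ (between-roots n N<n)) (proj₂ (between-roots n N<n)))
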